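{- Let $Z$ be an $n$-dimensional fake weighted projective space, and fix an isomorphism $\mathrm{Cl}(Z)\cong\mathbb{Z}\oplus\mathbb{Z}/\mu_1\mathbb{Z}\oplus\dots\oplus\mathbb{Z}/\mu_r\mathbb{Z}$ (with $\mu_r\mid\dots\mid\mu_1$) under which the classes of the torus-invariant prime divisors $D_0,\dots,D_n$ correspond to $\omega_i=(w_i,\eta_i)$ with $w_i\in\mathbb{Z}_{\ge1}$ and $\eta_{ik}\in\mathbb{Z}/\mu_k\mathbb{Z}$. Let $\eta'_{ik}\in\{0,\dots,\mu_k-1\}$ represent $\eta_{ik}$, set $L=\mathrm{lcm}(w_0,\dots,w_n)$, $L_{ik}=\frac{L}{w_i}\eta'_{ik}$, $M_k=\frac{\mu_k}{\gcd(\mu_k,L_{0k},\dots,L_{nk})}$ and $\alpha_k=\frac{LM_k}{\mu_k}$ for $k=1,\dots,r$. Then for all $k=1,\dots,r$: $$\frac{w_i}{\gcd(\alpha_k,w_i)}\ \Big|\ \eta'_{ik}\quad (i=0,\dots,n),\qquad \gcd\left(\mu_k,\ \frac{w_iw_j}{\gcd(\alpha_k,w_iw_j)};\ i,j=0,\dots,n\right)=1.$$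
   Context: A fake weighted projective space (fwps) of dimension $n$ is the toric variety $Z=Z(P)$ whose fan has as maximal cones the cones over the facets of $\mathrm{conv}(v_0,\dots,v_n)$, where $P=[v_0,\dots,v_n]$ is an integer $n\times(n+1)$ matrix whose columns are pairwise distinct primitive vectors generating $\mathbb{R}^n$ as a convex cone. Its class group is $\mathrm{Cl}(Z)\cong\mathbb{Z}^{n+1}/\mathrm{im}(P^T)$, with $e_i$ mapping to the class of the torus-invariant prime divisor $D_i$ corresponding to $v_i$. -}

module Defs where

open import Data.Nat as ℕ using (ℕ; zero; suc)
open import Data.Nat.DivMod using (_/_)
open import Data.Nat.GCD using (gcd)
open import Data.Nat.LCM using (lcm)
open import Data.Integer as ℤ using (ℤ; +_)
open import Data.Integer.Divisibility as ℤD using ()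
open import Data.Fin as Fin using (Fin)
open import Data.Product using (Σ; ∃; _×_; _,_)
open import Relation.Binary.PropositionalEquality using (_≡_; _≢_)
open import Relation.Nullary using (¬_)
open import Function using (_∘_; _⇔_)

sumℤ : ∀ {m} → (Fin m → ℤ) → ℤ
sumℤ {zero}  f = + 0
sumℤ {suc m} f = f Fin.zero ℤ.+ sumℤ (f ∘ Fin.suc)

gcdAll : ∀ {m} → (Fin m → ℕ) → ℕ
gcdAll {zero}  f = 0
gcdAll {suc m} f = gcd (f Fin.zero) (gcdAll (f ∘ Fin.suc))

lcmAll : ∀ {m} → (Fin m → ℕ) → ℕ
lcmAll {zero}  f = 1
lcmAll {suc m} f = lcm (f Fin.zero) (lcmAll (f ∘ Fin.suc))

-- total natural-number division (all divisions used below are exact with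
-- nonzero divisor under the hypotheses; the value at divisor 0 is irrelevant)
_÷_ : ℕ → ℕ → ℕ
m ÷ zero  = 0
m ÷ suc d = m / suc d

-- An integer n × (n+1) matrix P, P r i = r-th coordinate of column v_i.
Matrix : ℕ → Set
Matrix n = Fin n → Fin (suc n) → ℤ

PrimitiveColumn : ∀ {n} → Matrix n → Fin (suc n) → Set
PrimitiveColumn {n} P i = ∀ (d : ℕ) → (∀ r → (+ d) ℤD.∣ P r i) → d ≡ 1

DistinctColumns : ∀ {n} → Matrix n → Set
DistinctColumns {n} P = ∀ i j → i ≢ j → ¬ (∀ r → P r i ≡ P r j)

-- the columns generate ℝ^n as a convex cone; for integer vectors this means
-- every integer vector y has a positive multiple d·y that is a nonnegative
-- integer combination of the columns
ConeGenerating : ∀ {n} → Matrix n → Set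
ConeGenerating {n} P =
  ∀ (y : Fin n → ℤ) → Σ ℕ λ d → 1 ℕ.≤ d × Σ (Fin (suc n) → ℕ) λ c →
    ∀ r → (+ d) ℤ.* y r ≡ sumℤ (λ i → (+ c i) ℤ.* P r i)

IsFWPS : ∀ {n} → Matrix n → Set
IsFWPS P = (∀ i → PrimitiveColumn P i) × DistinctColumns P × ConeGenerating P

-- The homomorphism ℤ^{n+1} → ℤ ⊕ ⊕_k ℤ/μ_k, e_i ↦ (w_i, [η_ik]_k), induces an
-- isomorphism Cl(Z) = ℤ^{n+1}/im(Pᵀ) ≅ ℤ ⊕ ⊕_k ℤ/μ_k:
--  surjectivity, and kernel = im(Pᵀ).
ClIso : ∀ {n r} → Matrix n → (Fin (suc n) → ℕ) → (Fin r → ℕ) →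
        (Fin (suc n) → Fin r → ℕ) → Set
ClIso {n} {r} P w μ η =
  (∀ (a : ℤ) (b : Fin r → ℤ) → Σ (Fin (suc n) → ℤ) λ x →
      sumℤ (λ i → x i ℤ.* (+ w i)) ≡ a ×
      (∀ k → (+ μ k) ℤD.∣ (sumℤ (λ i → x i ℤ.* (+ η i k)) ℤ.- b k)))
  ×
  (∀ (x : Fin (suc n) → ℤ) →
      ((sumℤ (λ i → x i ℤ.* (+ w i)) ≡ + 0) ×
       (∀ k → (+ μ k) ℤD.∣ sumℤ (λ i → x i ℤ.* (+ η i k))))
      ⇔ (Σ (Fin n → ℤ) λ y → ∀ i → x i ≡ sumℤ (λ j → y j ℤ.* P j i)))

Lval : ∀ {n} → (Fin (suc n) → ℕ) → ℕ
Lval w = lcmAll w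

Lik : ∀ {n r} → (Fin (suc n) → ℕ) → (Fin (suc n) → Fin r → ℕ) → Fin (suc n) → Fin r → ℕ
Lik w η i k = (Lval w ÷ w i) ℕ.* η i k

Mk : ∀ {n r} → (Fin (suc n) → ℕ) → (Fin r → ℕ) → (Fin (suc n) → Fin r → ℕ) → Fin r → ℕ
Mk w μ η k = μ k ÷ gcd (μ k) (gcdAll (λ i → Lik w η i k))

αk : ∀ {n r} → (Fin (suc n) → ℕ) → (Fin r → ℕ) → (Fin (suc n) → Fin r → ℕ) → Fin r → ℕ
αk w μ η k = (Lval w ℕ.* Mk w μ η k) ÷ μ k

-- Write g = gcd(μ_k, L_0k, …, L_nk), so that M_k = μ_k / g. Surjectivity of
-- ℤ^{n+1} → Cl(Z) gives x with Σ x_i η_ik ≡ 1 (mod μ_k); since g divides μ_k and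
-- every L·η_ik = w_i·L_ik, it divides L = L·Σ x_i η_ik − L·(Σ x_i η_ik − 1).
-- Hence α_k = L/g, and η_ik·α_k·g = w_i·L_ik shows w_i ∣ η_ik·α_k, i.e.
-- w_i / gcd(α_k, w_i) ∣ η_ik. For the second claim, surjectivity also gives
-- Σ x_i w_i = 1, so a common divisor of all the w_i·w_j divides every w_i and
-- then 1; and each w_i·w_j / gcd(α_k, w_i·w_j) divides w_i·w_j.
module Submission where

open import Defs
open import Data.Nat using (ℕ; suc; _*_; _≤_; _<_)
open import Data.Nat.Divisibility using (_∣_)
open import Data.Nat.GCD using (gcd)
open import Data.Fin as Fin using (Fin)
open import Data.Product using (_×_)
open import Relation.Binary.PropositionalEquality using (_≡_)

open import Data.Nat using (zero; NonZero; ≢-nonZero; >-nonZero)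
open import Data.Nat.Properties using (*-comm; *-assoc; *-identityˡ; m<n⇒n≢0)
open import Data.Nat.Divisibility
  using (∣-trans; _∣0; 0∣⇒≡0; ∣1⇒≡1; n∣m*n; ∣n⇒∣m*n; *-monoʳ-∣; *-cancelʳ-∣; m/n∣m; m∣n*o⇒m/n∣o)
open import Data.Nat.DivMod using (_/_; m/n*n≡m; m*n/n≡m; m*[n/m]≡n)
open import Data.Nat.GCD
  using (gcd[m,n]∣m; gcd[m,n]∣n; gcd[m,n]≢0; gcd-greatest; c*gcd[m,n]≡gcd[cm,cn])
open import Data.Nat.LCM using (m∣lcm[m,n]; n∣lcm[m,n])
open import Data.Integer as ℤ using (ℤ; +_)
open import Data.Integer.Properties using (*-distribˡ-+; *-zeroʳ; pos-*)
import Data.Integer.Divisibility.Signed as ℤ∣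
open import Data.Integer.Solver using (module +-*-Solver)
open import Data.Product using (_,_)
open import Data.Sum using (inj₁; inj₂)
open import Function using (_∘_)
open import Relation.Binary.PropositionalEquality
  using (refl; sym; trans; cong; cong₂; subst; module ≡-Reasoning)

gcdAll[f]∣f : ∀ {m} (f : Fin m → ℕ) i → gcdAll f ∣ f i
gcdAll[f]∣f f Fin.zero    = gcd[m,n]∣m (f Fin.zero) (gcdAll (f ∘ Fin.suc))
gcdAll[f]∣f f (Fin.suc i) =
  ∣-trans (gcd[m,n]∣n (f Fin.zero) (gcdAll (f ∘ Fin.suc))) (gcdAll[f]∣f (f ∘ Fin.suc) i)

gcd[c,gcdAll²[F]]∣F : ∀ {m} c (F : Fin m → Fin m → ℕ) i j →
                      gcd c (gcdAll (λ i → gcdAll (F i))) ∣ F i j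
gcd[c,gcdAll²[F]]∣F c F i j = ∣-trans (gcd[m,n]∣n c _)
  (∣-trans (gcdAll[f]∣f (λ i → gcdAll (F i)) i) (gcdAll[f]∣f (F i) j))

f∣lcmAll[f] : ∀ {m} (f : Fin m → ℕ) i → f i ∣ lcmAll f
f∣lcmAll[f] f Fin.zero    = m∣lcm[m,n] (f Fin.zero) (lcmAll (f ∘ Fin.suc))
f∣lcmAll[f] f (Fin.suc i) =
  ∣-trans (f∣lcmAll[f] (f ∘ Fin.suc) i) (n∣lcm[m,n] (f Fin.zero) (lcmAll (f ∘ Fin.suc)))

m÷n≡m/n : ∀ m n .{{_ : NonZero n}} → m ÷ n ≡ m / n
m÷n≡m/n m (suc n) = refl

m÷n*n≡m : ∀ {m n} → n ∣ m → m ÷ n * n ≡ m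
m÷n*n≡m {n = zero}  0∣m = sym (0∣⇒≡0 0∣m)
m÷n*n≡m {n = suc _} n∣m = m/n*n≡m n∣m

n*[m÷n]≡m : ∀ {m n} → n ∣ m → n * (m ÷ n) ≡ m
n*[m÷n]≡m {m} {n} n∣m = trans (*-comm n (m ÷ n)) (m÷n*n≡m n∣m)

m÷n∣m : ∀ {m n} → n ∣ m → m ÷ n ∣ m
m÷n∣m {n = zero}  0∣m = 0∣m
m÷n∣m {n = suc _} n∣m = m/n∣m n∣m

m*[n÷d]÷n≡m÷d : ∀ m {n d} .{{_ : NonZero n}} → d ∣ m → d ∣ n → (m * (n ÷ d)) ÷ n ≡ m ÷ d
m*[n÷d]÷n≡m÷d m {suc _} {zero}  _   0∣n with () ← 0∣⇒≡0 0∣n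
m*[n÷d]÷n≡m÷d m {n@(suc _)} {d@(suc _)} d∣m d∣n =
  trans (cong (_/ n) m*[n/d]≡m/d*n) (m*n/n≡m (m / d) n)
  where
  open ≡-Reasoning
  m*[n/d]≡m/d*n : m * (n / d) ≡ m / d * n
  m*[n/d]≡m/d*n = begin
    m * (n / d)           ≡⟨ cong (_* (n / d)) (sym (m/n*n≡m d∣m)) ⟩
    m / d * d * (n / d)   ≡⟨ *-assoc (m / d) d (n / d) ⟩
    m / d * (d * (n / d)) ≡⟨ cong (m / d *_) (m*[n/m]≡n d∣n) ⟩
    m / d * n             ∎

∣*⇒÷gcd∣ : ∀ {w e α} → 1 ≤ w → w ∣ e * α → w ÷ gcd α w ∣ e
∣*⇒÷gcd∣ {w} {e} {α} 1≤w w∣eα =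
  subst (_∣ e) (sym (m÷n≡m/n w (gcd α w))) (m∣n*o⇒m/n∣o (gcd[m,n]∣n α w) w∣e*gcd)
  where
  instance
    gcd≢0 : NonZero (gcd α w)
    gcd≢0 = ≢-nonZero (gcd[m,n]≢0 α w (inj₂ (m<n⇒n≢0 1≤w)))
  w∣e*gcd : w ∣ e * gcd α w
  w∣e*gcd = subst (w ∣_) (sym (c*gcd[m,n]≡gcd[cm,cn] e α w)) (gcd-greatest w∣eα (n∣m*n e))

sumℤ-*ˡ : ∀ {m} c (x f : Fin m → ℤ) →
          sumℤ (λ i → x i ℤ.* (c ℤ.* f i)) ≡ c ℤ.* sumℤ (λ i → x i ℤ.* f i)
sumℤ-*ˡ {zero}  c x f = sym (*-zeroʳ c)
sumℤ-*ˡ {suc m} c x f = trans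
  (cong₂ ℤ._+_ (swap (x Fin.zero) (f Fin.zero)) (sumℤ-*ˡ c (x ∘ Fin.suc) (f ∘ Fin.suc)))
  (sym (*-distribˡ-+ c _ _))
  where
  open +-*-Solver
  swap : ∀ a b → a ℤ.* (c ℤ.* b) ≡ c ℤ.* (a ℤ.* b)
  swap a b = solve 3 (λ a b c → a :* (c :* b) := c :* (a :* b)) refl a b c

∣-sumℤ : ∀ {m d} (x f : Fin m → ℤ) → (∀ i → d ℤ∣.∣ f i) → d ℤ∣.∣ sumℤ (λ i → x i ℤ.* f i)
∣-sumℤ {zero}  x f d∣f = ℤ∣.∣ᵤ⇒∣ (_ ∣0)
∣-sumℤ {suc m} x f d∣f = ℤ∣.∣m∣n⇒∣m+n
  (ℤ∣.∣n⇒∣m*n (x Fin.zero) (d∣f Fin.zero)) (∣-sumℤ (x ∘ Fin.suc) (f ∘ Fin.suc) (d∣f ∘ Fin.suc))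

-- d ∣ a follows from d ∣ a·Σ x_i e_i and d ∣ a·(Σ x_i e_i − 1).
∣-cancel-unimodular : ∀ {m} (x : Fin m → ℤ) (e : Fin m → ℕ) {d a : ℕ} →
                      d ∣ ℤ.∣ sumℤ (λ i → x i ℤ.* + e i) ℤ.- + 1 ∣ →
                      (∀ i → d ∣ a * e i) → d ∣ a
∣-cancel-unimodular x e {d} {a} d∣S-1 d∣ae = ℤ∣.∣⇒∣ᵤ
  (subst (+ d ℤ∣.∣_) aS-a[S-1]≡a (ℤ∣.∣m∣n⇒∣m-n d∣aS (ℤ∣.∣n⇒∣m*n (+ a) (ℤ∣.∣ᵤ⇒∣ d∣S-1))))
  where
  S : ℤ
  S = sumℤ (λ i → x i ℤ.* + e i)
  d∣aS : + d ℤ∣.∣ + a ℤ.* S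
  d∣aS = subst (+ d ℤ∣.∣_) (sumℤ-*ˡ (+ a) x (λ i → + e i))
    (∣-sumℤ x _ (λ i → subst (+ d ℤ∣.∣_) (pos-* a (e i)) (ℤ∣.∣ᵤ⇒∣ (d∣ae i))))
  open +-*-Solver
  aS-a[S-1]≡a : + a ℤ.* S ℤ.- + a ℤ.* (S ℤ.- + 1) ≡ + a
  aS-a[S-1]≡a = solve 2 (λ a s → a :* s :- a :* (s :- con (+ 1)) := a) refl (+ a) S

∣products⇒∣1 : ∀ {m} (x : Fin m → ℤ) (w : Fin m → ℕ) → sumℤ (λ i → x i ℤ.* + w i) ≡ + 1 →
               ∀ {d} → (∀ i j → d ∣ w i * w j) → d ∣ 1
∣products⇒∣1 x w Σxw≡1 {d} d∣ww = ∣-cancel-unimodular x w unimodular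
  (λ i → subst (d ∣_) (sym (*-identityˡ (w i))) (∣-cancel-unimodular x w unimodular (d∣ww i)))
  where
  unimodular : d ∣ ℤ.∣ sumℤ (λ i → x i ℤ.* + w i) ℤ.- + 1 ∣
  unimodular = subst (λ s → d ∣ ℤ.∣ s ℤ.- + 1 ∣) (sym Σxw≡1) (d ∣0)

gcd[c,gcdAll²[F]]≡1 : ∀ {m} (x : Fin m → ℤ) (w : Fin m → ℕ) → sumℤ (λ i → x i ℤ.* + w i) ≡ + 1 →
                      ∀ c (F : Fin m → Fin m → ℕ) → (∀ i j → F i j ∣ w i * w j) →
                      gcd c (gcdAll (λ i → gcdAll (F i))) ≡ 1
gcd[c,gcdAll²[F]]≡1 x w Σxw≡1 c F F∣ww = ∣1⇒≡1
  (∣products⇒∣1 x w Σxw≡1 (λ i j → ∣-trans (gcd[c,gcdAll²[F]]∣F c F i j) (F∣ww i j)))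

Gk : ∀ {n r} → (Fin (suc n) → ℕ) → (Fin r → ℕ) → (Fin (suc n) → Fin r → ℕ) → Fin r → ℕ
Gk w μ η k = gcd (μ k) (gcdAll (λ i → Lik w η i k))

module _ {n r : ℕ} (w : Fin (suc n) → ℕ) (μ : Fin r → ℕ) (η : Fin (suc n) → Fin r → ℕ)
         (k : Fin r) where

  w*Lik≡L*η : ∀ i → w i * Lik w η i k ≡ Lval w * η i k
  w*Lik≡L*η i =
    trans (sym (*-assoc (w i) _ (η i k))) (cong (_* η i k) (n*[m÷n]≡m (f∣lcmAll[f] w i)))

  Gk∣Lik : ∀ i → Gk w μ η k ∣ Lik w η i k
  Gk∣Lik i = ∣-trans (gcd[m,n]∣n (μ k) _) (gcdAll[f]∣f (λ i → Lik w η i k) i)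

  Gk∣Lval : (x : Fin (suc n) → ℤ) → μ k ∣ ℤ.∣ sumℤ (λ i → x i ℤ.* + η i k) ℤ.- + 1 ∣ →
            Gk w μ η k ∣ Lval w
  Gk∣Lval x μ∣S-1 = ∣-cancel-unimodular x (λ i → η i k) (∣-trans (gcd[m,n]∣m (μ k) _) μ∣S-1)
    (λ i → subst (Gk w μ η k ∣_) (w*Lik≡L*η i) (∣n⇒∣m*n (w i) (Gk∣Lik i)))

  αk*Gk≡Lval : 1 ≤ μ k → Gk w μ η k ∣ Lval w → αk w μ η k * Gk w μ η k ≡ Lval w
  αk*Gk≡Lval 1≤μ G∣L = trans
    (cong (_* Gk w μ η k) (m*[n÷d]÷n≡m÷d (Lval w) {{>-nonZero 1≤μ}} G∣L (gcd[m,n]∣m (μ k) _)))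
    (m÷n*n≡m G∣L)

  w∣η*αk : 1 ≤ μ k → Gk w μ η k ∣ Lval w → ∀ i → w i ∣ η i k * αk w μ η k
  w∣η*αk 1≤μ G∣L i =
    *-cancelʳ-∣ G {{G≢0}} (subst (w i * G ∣_) w*Lik≡η*αk*G (*-monoʳ-∣ (w i) (Gk∣Lik i)))
    where
    G : ℕ
    G = Gk w μ η k
    G≢0 : NonZero G
    G≢0 = ≢-nonZero (gcd[m,n]≢0 (μ k) _ (inj₁ (m<n⇒n≢0 1≤μ)))
    open ≡-Reasoning
    w*Lik≡η*αk*G : w i * Lik w η i k ≡ η i k * αk w μ η k * G
    w*Lik≡η*αk*G = begin
      w i * Lik w η i k             ≡⟨ w*Lik≡L*η i ⟩
      Lval w * η i k                ≡⟨ *-comm (Lval w) (η i k) ⟩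
      η i k * Lval w                ≡⟨ cong (η i k *_) (sym (αk*Gk≡Lval 1≤μ G∣L)) ⟩
      η i k * (αk w μ η k * G)      ≡⟨ sym (*-assoc (η i k) _ G) ⟩
      η i k * αk w μ η k * G        ∎

lemma4p8 : (n r : ℕ) (P : Matrix n) (w : Fin (suc n) → ℕ) (μ : Fin r → ℕ)
    (η : Fin (suc n) → Fin r → ℕ) →
    IsFWPS P →
    (∀ i → 1 ≤ w i) →
    (∀ k → 1 ≤ μ k) →
    (∀ k l → k Fin.≤ l → μ l ∣ μ k) →
    (∀ i k → η i k < μ k) →
    ClIso P w μ η →
    ∀ (k : Fin r) →
      (∀ i → (w i ÷ gcd (αk w μ η k) (w i)) ∣ η i k) ×
      gcd (μ k) (gcdAll (λ i → gcdAll (λ j →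
        (w i * w j) ÷ gcd (αk w μ η k) (w i * w j)))) ≡ 1
lemma4p8 n r P w μ η _ 1≤w 1≤μ _ _ (surjective , _) k = w÷gcd∣η , gcd≡1
  where
  α : ℕ
  α = αk w μ η k
  G∣L : Gk w μ η k ∣ Lval w
  G∣L = let x , _ , μ∣Σxη-1 = surjective (+ 0) (λ _ → + 1) in
    Gk∣Lval w μ η k x (μ∣Σxη-1 k)
  w÷gcd∣η : ∀ i → w i ÷ gcd α (w i) ∣ η i k
  w÷gcd∣η i = ∣*⇒÷gcd∣ (1≤w i) (w∣η*αk w μ η k (1≤μ k) G∣L i)
  F : Fin (suc n) → Fin (suc n) → ℕ
  F i j = (w i * w j) ÷ gcd α (w i * w j)
  F∣ww : ∀ i j → F i j ∣ w i * w j
  F∣ww i j = m÷n∣m (gcd[m,n]∣n α (w i * w j))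
  gcd≡1 : gcd (μ k) (gcdAll (λ i → gcdAll (F i))) ≡ 1
  gcd≡1 = let x , Σxw≡1 , _ = surjective (+ 1) (λ _ → + 0) in
    gcd[c,gcdAll²[F]]≡1 x w Σxw≡1 (μ k) F F∣ww
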